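{- For all integers $n,r,p\ge1$, $$ \sum_{\ell=0}^{n} \ell^{p} H_{\ell}^{(r)}=A(p,r,n)H_{n}^{(r)}-B(p,r,n)\,, $$ where $$ A(p,r,n)=\sum_{\ell=0}^{p} S(p,\ell)\,\ell!\,\binom{n+r-1}{r-1}^{ -1}\binom{r+\ell-1}{\ell}\binom{r+n}{r+\ell},\qquad B(p,r,n)=\sum_{\ell=0}^{p} \frac{1}{r+\ell}S(p,\ell)\,\ell!\,\binom{r+\ell-1}{\ell}\binom{r+n-1}{r+\ell}\,. $$
   Context: $H_n=\sum_{j=1}^n\frac1j$; hyperharmonic numbers: $H_n^{(1)}=H_n$, $H_n^{(r)}=\sum_{\ell=1}^n H_\ell^{(r-1)}$ for $r\ge2$, and $H_0^{(r)}=0$. $S(p,\ell)$ are the Stirling numbers of the second kind; $\binom{a}{b}=0$ for $b>a$. -}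

module Defs where

open import Data.Nat using (ℕ; zero; suc; _∸_; _^_; _!) renaming (_+_ to _+ℕ_; _*_ to _*ℕ_)
open import Data.Nat.Combinatorics using (_C_)
open import Data.Integer using (+_)
open import Data.Rational using (ℚ; 0ℚ; 1ℚ; _+_; _*_; _-_; _/_)

toℚ : ℕ → ℚ
toℚ k = (+ k) / 1

-- reciprocal of a natural number (1/k); convention inv 0 = 0
-- (only ever applied to positive arguments below)
inv : ℕ → ℚ
inv zero = 0ℚ
inv (suc k) = (+ 1) / suc k

sumTo : ℕ → (ℕ → ℚ) → ℚ
sumTo zero f = f 0
sumTo (suc n) f = sumTo n f + f (suc n)

S : ℕ → ℕ → ℕ
S zero zero = 1
S zero (suc k) = 0
S (suc n) zero = 0
S (suc n) (suc k) = suc k *ℕ S n (suc k) +ℕ S n k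

H : ℕ → ℚ
H zero = 0ℚ
H (suc n) = H n + inv (suc n)

sum1 : ℕ → (ℕ → ℚ) → ℚ
sum1 zero f = 0ℚ
sum1 (suc n) f = sum1 n f + f (suc n)

-- hyperharmonic numbers H_n^{(r)}: HH r n.
-- H_n^{(1)} = H_n, H_n^{(r)} = Σ_{ℓ=1}^n H_ℓ^{(r-1)} (r ≥ 2).
-- (r = 0 is not used; set to 0.)
HH : ℕ → ℕ → ℚ
HH zero n = 0ℚ
HH (suc zero) n = H n
HH (suc (suc r)) n = sum1 n (HH (suc r))

A : ℕ → ℕ → ℕ → ℚ
A p r n = sumTo p (λ ℓ →
  toℚ (S p ℓ *ℕ ℓ !) * inv ((n +ℕ r ∸ 1) C (r ∸ 1))
    * toℚ ((r +ℕ ℓ ∸ 1) C ℓ) * toℚ ((r +ℕ n) C (r +ℕ ℓ)))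

B : ℕ → ℕ → ℕ → ℚ
B p r n = sumTo p (λ ℓ →
  inv (r +ℕ ℓ) * toℚ (S p ℓ *ℕ ℓ !)
    * toℚ ((r +ℕ ℓ ∸ 1) C ℓ) * toℚ ((r +ℕ n ∸ 1) C (r +ℕ ℓ)))

-- Expanding ℓ^p = Σ_k S(p,k) k! C(ℓ,k) and exchanging the sums reduces the identity to the
-- inner sums Σ_ℓ C(ℓ,k) H_ℓ^(r).  For r = s+1 the hyperharmonic numbers have the closed form
-- H_ℓ^(s+1) = C(s+ℓ,s) (H_{s+ℓ} − H_s), and the trinomial revision
-- C(ℓ,k) C(s+ℓ,s) = C(s+k,k) C(s+ℓ,s+k) turns each inner sum into Σ_ℓ C(s+ℓ,m) (H_{s+ℓ} − H_s)
-- with m = s+k ≥ s.  This sum telescopes by Pascal's rule and the absorption identity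
-- C(N+1,m+1)/(N+1) = C(N,m)/(m+1); the case m = s of the same sum gives the closed form by
-- induction on s.

module Submission where

open import Defs
open import Relation.Binary.PropositionalEquality

module Binomial where

  open import Data.Nat
  open import Data.Nat.Properties
  open import Data.Nat.Combinatorics using (_C_; nCk≡nC[n∸k]; nCn≡1; nCk+nC[k+1]≡[n+1]C[k+1])
  open import Data.Nat.Tactic.RingSolver using (solve-∀)
  open import Relation.Nullary using (yes; no)
  open import Data.Product using (_,_)
  open ≡-Reasoning

  choose : ℕ → ℕ → ℕ
  choose n       zero    = 1
  choose zero    (suc k) = 0
  choose (suc n) (suc k) = choose n k + choose n (suc k)

  choose≡C : ∀ n k → choose n k ≡ n C k
  choose≡C n       zero    = sym (trans (nCk≡nC[n∸k] {0} {n} z≤n) (nCn≡1 n))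
  choose≡C zero    (suc k) = refl
  choose≡C (suc n) (suc k) =
    trans (cong₂ _+_ (choose≡C n k) (choose≡C n (suc k))) (nCk+nC[k+1]≡[n+1]C[k+1] n k)

  choose-< : ∀ {n k} → n < k → choose n k ≡ 0
  choose-< {zero}  {suc k} _         = refl
  choose-< {suc n} {suc k} (s≤s n<k) = cong₂ _+_ (choose-< n<k) (choose-< (m<n⇒m<1+n n<k))

  choose-diag : ∀ n → choose n n ≡ 1
  choose-diag zero    = refl
  choose-diag (suc n) = cong₂ _+_ (choose-diag n) (choose-< (n<1+n n))

  choose-pos : ∀ a b → 0 < choose (a + b) a
  choose-pos zero    b = s≤s z≤n
  choose-pos (suc a) b = ≤-trans (choose-pos a b) (m≤m+n _ _)

  choose-1 : ∀ n → choose n 1 ≡ n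
  choose-1 zero    = refl
  choose-1 (suc n) = cong suc (choose-1 n)

  choose-absorb : ∀ n k → suc k * choose (suc n) (suc k) ≡ suc n * choose n k
  choose-absorb zero    zero    = refl
  choose-absorb zero    (suc k) = *-zeroʳ (suc (suc k))
  choose-absorb (suc n) zero    = cong suc (trans (+-identityʳ _) (trans (choose-1 (suc n)) (sym (*-identityʳ (suc n)))))
  choose-absorb (suc n) (suc k) = begin
    suc (suc k) * (x + y)                  ≡⟨ regroup (suc k) x y ⟩
    suc k * x + x + suc (suc k) * y        ≡⟨ cong₂ (λ u v → u + x + v) (choose-absorb n k) (choose-absorb n (suc k)) ⟩
    suc n * a + (a + b) + suc n * b        ≡⟨ collect (suc n) a b ⟩
    suc (suc n) * (a + b)                  ∎
    where
    a = choose n k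
    b = choose n (suc k)
    x = choose (suc n) (suc k)
    y = choose (suc n) (suc (suc k))
    regroup : ∀ k x y → (1 + k) * (x + y) ≡ k * x + x + (1 + k) * y
    regroup = solve-∀
    collect : ∀ n a b → n * a + (a + b) + n * b ≡ (1 + n) * (a + b)
    collect = solve-∀

  *-choose : ∀ n k → n * choose n k ≡ k * choose n k + suc k * choose n (suc k)
  *-choose zero    zero    = refl
  *-choose zero    (suc k) = sym (cong₂ _+_ (*-zeroʳ (suc k)) (*-zeroʳ (suc (suc k))))
  *-choose (suc n) k       = trans (lower k) (cong (k * choose (suc n) k +_) (sym (choose-absorb n k)))
    where
    lower : ∀ k → suc n * choose (suc n) k ≡ k * choose (suc n) k + suc n * choose n k
    lower zero     = refl
    lower (suc k′) = begin
      suc n * (choose n k′ + choose n (suc k′))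
        ≡⟨ *-distribˡ-+ (suc n) (choose n k′) (choose n (suc k′)) ⟩
      suc n * choose n k′ + suc n * choose n (suc k′)
        ≡⟨ cong (_+ suc n * choose n (suc k′)) (sym (choose-absorb n k′)) ⟩
      suc k′ * (choose n k′ + choose n (suc k′)) + suc n * choose n (suc k′) ∎

  choose-factorial : ∀ a b → choose (a + b) a * (a ! * b !) ≡ (a + b) !
  choose-factorial zero    b = trans (*-identityˡ _) (+-identityʳ _)
  choose-factorial (suc a) zero rewrite +-identityʳ a | choose-diag (suc a) = trans (*-identityˡ _) (*-identityʳ _)
  choose-factorial (suc a) (suc b) = begin
    (x + y) * (suc a * a ! * (suc b * b !))
      ≡⟨ split-factorials x y (suc a) (suc b) (a !) (b !) ⟩
    suc a * (x * (a ! * suc b !)) + suc b * (y * (suc a ! * b !))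
      ≡⟨ cong₂ (λ u v → suc a * u + suc b * v) (choose-factorial a (suc b)) shifted ⟩
    suc a * (a + suc b) ! + suc b * (a + suc b) !
      ≡⟨ collect a b ((a + suc b) !) ⟩
    suc (a + suc b) * (a + suc b) ! ∎
    where
    x = choose (a + suc b) a
    y = choose (a + suc b) (suc a)
    shifted : y * (suc a ! * b !) ≡ (a + suc b) !
    shifted rewrite +-suc a b = choose-factorial (suc a) b
    split-factorials : ∀ x y a b fa fb → (x + y) * (a * fa * (b * fb)) ≡ a * (x * (fa * (b * fb))) + b * (y * (a * fa * fb))
    split-factorials = solve-∀
    collect : ∀ a b m → (1 + a) * m + (1 + b) * m ≡ (1 + (a + (1 + b))) * m
    collect = solve-∀

  choose-sym : ∀ a b → choose (a + b) a ≡ choose (a + b) b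
  choose-sym a b = *-cancelʳ-≡ _ _ (a ! * b !) {{a !* b !≢0}} (trans (choose-factorial a b) (sym swapped))
    where
    swapped : choose (a + b) b * (a ! * b !) ≡ (a + b) !
    swapped rewrite +-comm a b | *-comm (a !) (b !) = choose-factorial b a

  choose-revision-+ : ∀ r k j → choose (k + j) k * choose (r + (k + j)) r ≡ choose (r + k) k * choose (r + (k + j)) (r + k)
  choose-revision-+ r k j = *-cancelʳ-≡ _ _ (r ! * (k ! * j !)) {{m*n≢0 (r !) (k ! * j !) {{r !≢0}} {{k !* j !≢0}}}}
    (trans lhs-multinomial (sym rhs-multinomial))
    where
    lhs-multinomial : choose (k + j) k * choose (r + (k + j)) r * (r ! * (k ! * j !)) ≡ (r + (k + j)) !
    lhs-multinomial = begin
      choose (k + j) k * choose (r + (k + j)) r * (r ! * (k ! * j !))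
        ≡⟨ rearrange (choose (k + j) k) (choose (r + (k + j)) r) (r !) (k !) (j !) ⟩
      choose (r + (k + j)) r * (r ! * (choose (k + j) k * (k ! * j !)))
        ≡⟨ cong (λ z → choose (r + (k + j)) r * (r ! * z)) (choose-factorial k j) ⟩
      choose (r + (k + j)) r * (r ! * (k + j) !)
        ≡⟨ choose-factorial r (k + j) ⟩
      (r + (k + j)) ! ∎
      where
      rearrange : ∀ x y fr fk fj → x * y * (fr * (fk * fj)) ≡ y * (fr * (x * (fk * fj)))
      rearrange = solve-∀
    rhs-multinomial : choose (r + k) k * choose (r + (k + j)) (r + k) * (r ! * (k ! * j !)) ≡ (r + (k + j)) !
    rhs-multinomial rewrite sym (+-assoc r k j) = begin
      choose (r + k) k * choose (r + k + j) (r + k) * (r ! * (k ! * j !))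
        ≡⟨ rearrange (choose (r + k) k) (choose (r + k + j) (r + k)) (r !) (k !) (j !) ⟩
      choose (r + k + j) (r + k) * (choose (r + k) k * (r ! * k !) * j !)
        ≡⟨ cong (λ z → choose (r + k + j) (r + k) * (z * j !)) (trans (cong (_* (r ! * k !)) (sym (choose-sym r k))) (choose-factorial r k)) ⟩
      choose (r + k + j) (r + k) * ((r + k) ! * j !)
        ≡⟨ choose-factorial (r + k) j ⟩
      (r + k + j) ! ∎
      where
      rearrange : ∀ x y fr fk fj → x * y * (fr * (fk * fj)) ≡ y * (x * (fr * fk) * fj)
      rearrange = solve-∀

  choose-revision : ∀ r k l → choose l k * choose (r + l) r ≡ choose (r + k) k * choose (r + l) (r + k)
  choose-revision r k l with k ≤? l
  ... | yes k≤l with j , refl ← m≤n⇒∃[o]m+o≡n k≤l = choose-revision-+ r k j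
  ... | no k≰l  = begin
    choose l k * choose (r + l) r                 ≡⟨ cong (_* choose (r + l) r) (choose-< l<k) ⟩
    0                                            ≡⟨ sym (*-zeroʳ (choose (r + k) k)) ⟩
    choose (r + k) k * 0                         ≡⟨ cong (choose (r + k) k *_) (sym (choose-< (+-monoʳ-< r l<k))) ⟩
    choose (r + k) k * choose (r + l) (r + k)     ∎
    where l<k = ≰⇒> k≰l

module StirlingNumbers where

  open import Data.Nat
  open import Data.Nat.Properties
  open import Data.Nat.Tactic.RingSolver using (solve-∀)
  open Binomial
  open ≡-Reasoning

  S-< : ∀ {p k} → p < k → S p k ≡ 0
  S-< {zero}  {suc k} _         = refl
  S-< {suc p} {suc k} (s≤s p<k) rewrite S-< (m<n⇒m<1+n p<k) | S-< p<k = trans (+-identityʳ _) (*-zeroʳ k)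

  *-Stirling-term : ∀ p l k → l * (S p k * k ! * choose l k) ≡ k * (S p k * k ! * choose l k) + S p k * suc k ! * choose l (suc k)
  *-Stirling-term p l k = begin
    l * (S p k * k ! * choose l k)                                   ≡⟨ pull-out l (S p k * k !) (choose l k) ⟩
    S p k * k ! * (l * choose l k)                                   ≡⟨ cong (S p k * k ! *_) (*-choose l k) ⟩
    S p k * k ! * (k * choose l k + suc k * choose l (suc k))         ≡⟨ expand (S p k) (k !) k (choose l k) (choose l (suc k)) ⟩
    k * (S p k * k ! * choose l k) + S p k * suc k ! * choose l (suc k) ∎
    where
    pull-out : ∀ l x c → l * (x * c) ≡ x * (l * c)
    pull-out = solve-∀
    expand : ∀ s f k c c′ → s * f * (k * c + (1 + k) * c′) ≡ k * (s * f * c) + s * ((1 + k) * f) * c′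
    expand = solve-∀

  Stirling-term-suc : ∀ p l k → suc k * (S p (suc k) * suc k ! * choose l (suc k)) + S p k * suc k ! * choose l (suc k)
                               ≡ S (suc p) (suc k) * suc k ! * choose l (suc k)
  Stirling-term-suc p l k = collect (suc k) (S p (suc k)) (S p k) (suc k !) (choose l (suc k))
    where
    collect : ∀ k a b f c → k * (a * f * c) + b * f * c ≡ (k * a + b) * f * c
    collect = solve-∀

open Binomial
open StirlingNumbers

open import Data.Nat as ℕ using (ℕ; zero; suc; _≤_; _<_; _^_; _!; _∸_; s≤s; z≤n)
open import Data.Nat.Combinatorics using (_C_)
import Data.Nat.Properties as ℕ
import Data.Integer as ℤ
import Data.Integer.Tactic.RingSolver as ℤ-Solver
import Data.Integer.Properties as ℤ
open import Data.Rational using (ℚ; 0ℚ; 1ℚ; _+_; _*_; _-_; fromℚᵘ)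
open import Data.Rational.Properties
import Data.Rational.Unnormalised as ℚᵘ
import Data.Rational.Unnormalised.Properties as ℚᵘ
open import Level using (0ℓ)
open import Relation.Nullary.Decidable using (dec⇒maybe)
open import Tactic.RingSolver using (solve-∀)
open import Tactic.RingSolver.Core.AlmostCommutativeRing using (AlmostCommutativeRing; fromCommutativeRing)

ℚ-ring : AlmostCommutativeRing 0ℓ 0ℓ
ℚ-ring = fromCommutativeRing +-*-commutativeRing (λ x → dec⇒maybe (0ℚ ≟ x))

fromℚᵘ-+ : ∀ x y → fromℚᵘ x + fromℚᵘ y ≡ fromℚᵘ (x ℚᵘ.+ y)
fromℚᵘ-+ x y = toℚᵘ-injective (ℚᵘ.≃-trans (toℚᵘ-homo-+ (fromℚᵘ x) (fromℚᵘ y))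
  (ℚᵘ.≃-trans (ℚᵘ.+-cong (toℚᵘ-fromℚᵘ x) (toℚᵘ-fromℚᵘ y)) (ℚᵘ.≃-sym (toℚᵘ-fromℚᵘ _))))

fromℚᵘ-* : ∀ x y → fromℚᵘ x * fromℚᵘ y ≡ fromℚᵘ (x ℚᵘ.* y)
fromℚᵘ-* x y = toℚᵘ-injective (ℚᵘ.≃-trans (toℚᵘ-homo-* (fromℚᵘ x) (fromℚᵘ y))
  (ℚᵘ.≃-trans (ℚᵘ.*-cong (toℚᵘ-fromℚᵘ x) (toℚᵘ-fromℚᵘ y)) (ℚᵘ.≃-sym (toℚᵘ-fromℚᵘ _))))

toℚ-+ : ∀ a b → toℚ (a ℕ.+ b) ≡ toℚ a + toℚ b
toℚ-+ a b = sym (trans (fromℚᵘ-+ (ℚᵘ.mkℚᵘ (ℤ.+ a) 0) (ℚᵘ.mkℚᵘ (ℤ.+ b) 0))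
  (fromℚᵘ-cong {ℚᵘ.mkℚᵘ (ℤ.+ a) 0 ℚᵘ.+ ℚᵘ.mkℚᵘ (ℤ.+ b) 0} {ℚᵘ.mkℚᵘ (ℤ.+ (a ℕ.+ b)) 0}
    (ℚᵘ.*≡* (trans (+-over-1 (ℤ.+ a) (ℤ.+ b)) (cong (ℤ._* ℤ.1ℤ) (sym (ℤ.pos-+ a b)))))))
  where
  +-over-1 : ∀ x y → (x ℤ.* ℤ.1ℤ ℤ.+ y ℤ.* ℤ.1ℤ) ℤ.* ℤ.1ℤ ≡ (x ℤ.+ y) ℤ.* ℤ.1ℤ
  +-over-1 = ℤ-Solver.solve-∀

toℚ-* : ∀ a b → toℚ (a ℕ.* b) ≡ toℚ a * toℚ b
toℚ-* a b = sym (trans (fromℚᵘ-* (ℚᵘ.mkℚᵘ (ℤ.+ a) 0) (ℚᵘ.mkℚᵘ (ℤ.+ b) 0))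
  (fromℚᵘ-cong {ℚᵘ.mkℚᵘ (ℤ.+ a) 0 ℚᵘ.* ℚᵘ.mkℚᵘ (ℤ.+ b) 0} {ℚᵘ.mkℚᵘ (ℤ.+ (a ℕ.* b)) 0}
    (ℚᵘ.*≡* (cong (ℤ._* ℤ.1ℤ) (sym (ℤ.pos-* a b))))))

inv-*-toℚ : ∀ k → 0 < k → inv k * toℚ k ≡ 1ℚ
inv-*-toℚ (suc k) _ = trans (fromℚᵘ-* (ℚᵘ.mkℚᵘ (ℤ.+ 1) k) (ℚᵘ.mkℚᵘ (ℤ.+ suc k) 0))
  (fromℚᵘ-cong {ℚᵘ.mkℚᵘ (ℤ.+ 1) k ℚᵘ.* ℚᵘ.mkℚᵘ (ℤ.+ suc k) 0} {ℚᵘ.mkℚᵘ (ℤ.+ 1) 0}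
    (ℚᵘ.*≡* (trans (ℤ.*-identityʳ _) (trans (ℤ.*-identityˡ _)
      (trans (cong ℤ.+_ (sym (ℕ.*-identityʳ (suc k)))) (sym (ℤ.*-identityˡ _)))))))

open ≡-Reasoning

sumTo-cong : ∀ n {f g : ℕ → ℚ} → (∀ k → f k ≡ g k) → sumTo n f ≡ sumTo n g
sumTo-cong zero    f≡g = f≡g 0
sumTo-cong (suc n) f≡g = cong₂ _+_ (sumTo-cong n f≡g) (f≡g (suc n))

sum1-cong : ∀ n {f g : ℕ → ℚ} → (∀ k → f k ≡ g k) → sum1 n f ≡ sum1 n g
sum1-cong zero    f≡g = refl
sum1-cong (suc n) f≡g = cong₂ _+_ (sum1-cong n f≡g) (f≡g (suc n))

sum1≡sumTo : ∀ n (f : ℕ → ℚ) → f 0 ≡ 0ℚ → sum1 n f ≡ sumTo n f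
sum1≡sumTo zero    f f0≡0 = sym f0≡0
sum1≡sumTo (suc n) f f0≡0 = cong (_+ f (suc n)) (sum1≡sumTo n f f0≡0)

sumTo-+ : ∀ n (f g : ℕ → ℚ) → sumTo n (λ k → f k + g k) ≡ sumTo n f + sumTo n g
sumTo-+ zero    f g = refl
sumTo-+ (suc n) f g = trans (cong (_+ (f (suc n) + g (suc n))) (sumTo-+ n f g))
  (interchange (sumTo n f) (sumTo n g) (f (suc n)) (g (suc n)))
  where
  interchange : ∀ a b c d → a + b + (c + d) ≡ a + c + (b + d)
  interchange = solve-∀ ℚ-ring

sumTo-*ˡ : ∀ n a (f : ℕ → ℚ) → sumTo n (λ k → a * f k) ≡ a * sumTo n f
sumTo-*ˡ zero    a f = refl
sumTo-*ˡ (suc n) a f = trans (cong (_+ a * f (suc n)) (sumTo-*ˡ n a f))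
  (sym (*-distribˡ-+ a (sumTo n f) (f (suc n))))

sumTo-*ʳ : ∀ n a (f : ℕ → ℚ) → sumTo n (λ k → f k * a) ≡ sumTo n f * a
sumTo-*ʳ zero    a f = refl
sumTo-*ʳ (suc n) a f = trans (cong (_+ f (suc n) * a) (sumTo-*ʳ n a f))
  (sym (*-distribʳ-+ a (sumTo n f) (f (suc n))))

sumTo-*-affine : ∀ n h (a x y : ℕ → ℚ) →
  sumTo n (λ k → a k * (x k * h - y k)) ≡ sumTo n (λ k → a k * x k) * h - sumTo n (λ k → a k * y k)
sumTo-*-affine zero    h a x y = distrib (a 0) (x 0) h (y 0)
  where
  distrib : ∀ a x h y → a * (x * h - y) ≡ a * x * h - a * y
  distrib = solve-∀ ℚ-ring
sumTo-*-affine (suc n) h a x y = trans (cong (_+ a (suc n) * (x (suc n) * h - y (suc n))) (sumTo-*-affine n h a x y))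
  (collect (sumTo n (λ k → a k * x k)) (sumTo n (λ k → a k * y k)) (a (suc n)) (x (suc n)) h (y (suc n)))
  where
  collect : ∀ s t a x h y → s * h - t + a * (x * h - y) ≡ (s + a * x) * h - (t + a * y)
  collect = solve-∀ ℚ-ring

sumTo-swap : ∀ n p (f : ℕ → ℕ → ℚ) → sumTo n (λ l → sumTo p (f l)) ≡ sumTo p (λ k → sumTo n (λ l → f l k))
sumTo-swap zero    p f = refl
sumTo-swap (suc n) p f = trans (cong (_+ sumTo p (f (suc n))) (sumTo-swap n p f))
  (sym (sumTo-+ p (λ k → sumTo n (λ l → f l k)) (f (suc n))))

sumTo-suc-shift : ∀ n (f : ℕ → ℚ) → f 0 ≡ 0ℚ → sumTo (suc n) f ≡ sumTo n (λ k → f (suc k))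
sumTo-suc-shift zero    f f0≡0 = trans (cong (_+ f 1) f0≡0) (+-identityˡ (f 1))
sumTo-suc-shift (suc n) f f0≡0 = cong (_+ f (suc (suc n))) (sumTo-suc-shift n f f0≡0)

Stirling-expansion : ∀ p l → toℚ (l ^ p) ≡ sumTo p (λ k → toℚ (S p k ℕ.* k ! ℕ.* choose l k))
Stirling-expansion zero    l = refl
Stirling-expansion (suc p) l = begin
  toℚ (l ℕ.* l ^ p)                                ≡⟨ toℚ-* l (l ^ p) ⟩
  toℚ l * toℚ (l ^ p)                              ≡⟨ cong (toℚ l *_) (Stirling-expansion p l) ⟩
  toℚ l * sumTo p (λ k → toℚ (t k))                ≡⟨ sumTo-*ˡ p (toℚ l) (λ k → toℚ (t k)) ⟨
  sumTo p (λ k → toℚ l * toℚ (t k))                ≡⟨ sumTo-cong p split ⟩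
  sumTo p (λ k → toℚ (k ℕ.* t k) + u k)            ≡⟨ sumTo-+ p (λ k → toℚ (k ℕ.* t k)) u ⟩
  sumTo p (λ k → toℚ (k ℕ.* t k)) + sumTo p u      ≡⟨ cong (_+ sumTo p u) reindex ⟩
  sumTo p (λ k → toℚ (suc k ℕ.* t (suc k))) + sumTo p u
    ≡⟨ sumTo-+ p (λ k → toℚ (suc k ℕ.* t (suc k))) u ⟨
  sumTo p (λ k → toℚ (suc k ℕ.* t (suc k)) + u k)  ≡⟨ sumTo-cong p merge ⟩
  sumTo p (λ k → toℚ (t′ (suc k)))                 ≡⟨ sumTo-suc-shift p (λ k → toℚ (t′ k)) refl ⟨
  sumTo (suc p) (λ k → toℚ (t′ k))                 ∎
  where
  t t′ : ℕ → ℕ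
  t  k = S p k ℕ.* k ! ℕ.* choose l k
  t′ k = S (suc p) k ℕ.* k ! ℕ.* choose l k
  u : ℕ → ℚ
  u k = toℚ (S p k ℕ.* suc k ! ℕ.* choose l (suc k))
  split : ∀ k → toℚ l * toℚ (t k) ≡ toℚ (k ℕ.* t k) + u k
  split k = trans (sym (toℚ-* l (t k))) (trans (cong toℚ (*-Stirling-term p l k)) (toℚ-+ (k ℕ.* t k) _))
  merge : ∀ k → toℚ (suc k ℕ.* t (suc k)) + u k ≡ toℚ (t′ (suc k))
  merge k = trans (sym (toℚ-+ (suc k ℕ.* t (suc k)) _)) (cong toℚ (Stirling-term-suc p l k))
  top-vanishes : toℚ (suc p ℕ.* t (suc p)) ≡ 0ℚ
  top-vanishes = cong toℚ (trans (cong (λ s → suc p ℕ.* (s ℕ.* suc p ! ℕ.* choose l (suc p))) (S-< (ℕ.n<1+n p)))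
                                 (ℕ.*-zeroʳ (suc p)))
  reindex : sumTo p (λ k → toℚ (k ℕ.* t k)) ≡ sumTo p (λ k → toℚ (suc k ℕ.* t (suc k)))
  reindex = begin
    sumTo p (λ k → toℚ (k ℕ.* t k))         ≡⟨ +-identityʳ _ ⟨
    sumTo p (λ k → toℚ (k ℕ.* t k)) + 0ℚ    ≡⟨ cong (sumTo p (λ k → toℚ (k ℕ.* t k)) +_) top-vanishes ⟨
    sumTo (suc p) (λ k → toℚ (k ℕ.* t k))   ≡⟨ sumTo-suc-shift p (λ k → toℚ (k ℕ.* t k)) refl ⟩
    sumTo p (λ k → toℚ (suc k ℕ.* t (suc k))) ∎

sumTo-power-weighted : ∀ p n (w : ℕ → ℚ) →
  sumTo n (λ l → toℚ (l ^ p) * w l) ≡ sumTo p (λ k → toℚ (S p k ℕ.* k !) * sumTo n (λ l → toℚ (choose l k) * w l))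
sumTo-power-weighted p n w = begin
  sumTo n (λ l → toℚ (l ^ p) * w l)
    ≡⟨ sumTo-cong n (λ l → trans (cong (_* w l) (Stirling-expansion p l)) (sym (sumTo-*ʳ p (w l) _))) ⟩
  sumTo n (λ l → sumTo p (λ k → toℚ (a k ℕ.* choose l k) * w l))
    ≡⟨ sumTo-swap n p (λ l k → toℚ (a k ℕ.* choose l k) * w l) ⟩
  sumTo p (λ k → sumTo n (λ l → toℚ (a k ℕ.* choose l k) * w l))
    ≡⟨ sumTo-cong p (λ k → trans (sumTo-cong n (λ l → factor k l)) (sumTo-*ˡ n (toℚ (a k)) _)) ⟩
  sumTo p (λ k → toℚ (a k) * sumTo n (λ l → toℚ (choose l k) * w l)) ∎
  where
  a : ℕ → ℕ
  a k = S p k ℕ.* k !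
  factor : ∀ k l → toℚ (a k ℕ.* choose l k) * w l ≡ toℚ (a k) * (toℚ (choose l k) * w l)
  factor k l = trans (cong (_* w l) (toℚ-* (a k) (choose l k))) (*-assoc (toℚ (a k)) _ (w l))

cross-multiply : ∀ {a b} x y → 0 < a → 0 < b → b ℕ.* x ≡ a ℕ.* y → toℚ x * inv a ≡ toℚ y * inv b
cross-multiply {a} {b} x y 0<a 0<b bx≡ay = begin
  toℚ x * inv a                          ≡⟨ *-identityʳ _ ⟨
  toℚ x * inv a * 1ℚ                     ≡⟨ cong (toℚ x * inv a *_) (inv-*-toℚ b 0<b) ⟨
  toℚ x * inv a * (inv b * toℚ b)        ≡⟨ bring-left (toℚ x) (inv a) (inv b) (toℚ b) ⟩
  toℚ b * toℚ x * inv a * inv b          ≡⟨ cong (λ z → z * inv a * inv b) (trans (sym (toℚ-* b x)) (trans (cong toℚ bx≡ay) (toℚ-* a y))) ⟩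
  toℚ a * toℚ y * inv a * inv b          ≡⟨ bring-right (toℚ a) (toℚ y) (inv a) (inv b) ⟩
  toℚ y * inv b * (inv a * toℚ a)        ≡⟨ cong (toℚ y * inv b *_) (inv-*-toℚ a 0<a) ⟩
  toℚ y * inv b * 1ℚ                     ≡⟨ *-identityʳ _ ⟩
  toℚ y * inv b                          ∎
  where
  bring-left : ∀ x i j b → x * i * (j * b) ≡ b * x * i * j
  bring-left = solve-∀ ℚ-ring
  bring-right : ∀ a y i j → a * y * i * j ≡ y * j * (i * a)
  bring-right = solve-∀ ℚ-ring

choose-absorbℚ : ∀ N m → toℚ (choose (suc N) (suc m)) * inv (suc N) ≡ toℚ (choose N m) * inv (suc m)
choose-absorbℚ N m = cross-multiply {suc N} {suc m} (choose (suc N) (suc m)) (choose N m) (s≤s z≤n) (s≤s z≤n) (choose-absorb N m)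

Htail : ℕ → ℕ → ℚ
Htail r n = H (r ℕ.+ n) - H r

Htail-zero : ∀ r → Htail r 0 ≡ 0ℚ
Htail-zero r rewrite ℕ.+-identityʳ r = +-inverseʳ (H r)

sumTo-choose-Htail : ∀ {r m} n → r ≤ m →
  sumTo n (λ l → toℚ (choose (r ℕ.+ l) m) * Htail r l)
    ≡ toℚ (choose (suc (r ℕ.+ n)) (suc m)) * Htail r n - inv (suc m) * toℚ (choose (r ℕ.+ n) (suc m))
sumTo-choose-Htail {r} {m} zero r≤m rewrite Htail-zero r | ℕ.+-identityʳ r = begin
  toℚ (choose r m) * 0ℚ                                               ≡⟨ vanish (toℚ (choose r m)) (toℚ (choose (suc r) (suc m))) (inv (suc m)) ⟩
  toℚ (choose (suc r) (suc m)) * 0ℚ - inv (suc m) * toℚ 0              ≡⟨ cong (λ z → toℚ (choose (suc r) (suc m)) * 0ℚ - inv (suc m) * toℚ z) (choose-< (s≤s r≤m)) ⟨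
  toℚ (choose (suc r) (suc m)) * 0ℚ - inv (suc m) * toℚ (choose r (suc m)) ∎
  where
  vanish : ∀ a b i → a * 0ℚ ≡ b * 0ℚ - i * 0ℚ
  vanish = solve-∀ ℚ-ring
sumTo-choose-Htail {r} {m} (suc n) r≤m rewrite ℕ.+-suc r n = begin
  sumTo n (λ l → toℚ (choose (r ℕ.+ l) m) * Htail r l) + c * (HN + iN - Hr)
    ≡⟨ cong (_+ c * (HN + iN - Hr)) (sumTo-choose-Htail n r≤m) ⟩
  P * (HN - Hr) - im * b + c * (HN + iN - Hr)
    ≡⟨ regroup P b c HN Hr iN im ⟩
  (c + P) * (HN + iN - Hr) - P * iN - im * b
    ≡⟨ cong₂ (λ u v → u * (HN + iN - Hr) - v - im * b) (sym (toℚ-+ (choose (suc N) m) _)) (choose-absorbℚ N m) ⟩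
  Q * (HN + iN - Hr) - a * im - im * b
    ≡⟨ collect Q (HN + iN - Hr) a b im ⟩
  Q * (HN + iN - Hr) - im * (a + b)
    ≡⟨ cong (λ u → Q * (HN + iN - Hr) - im * u) (sym (toℚ-+ (choose N m) _)) ⟩
  Q * (HN + iN - Hr) - im * P ∎
  where
  N = r ℕ.+ n
  HN = H N
  Hr = H r
  iN = inv (suc N)
  im = inv (suc m)
  a = toℚ (choose N m)
  b = toℚ (choose N (suc m))
  c = toℚ (choose (suc N) m)
  P = toℚ (choose (suc N) (suc m))
  Q = toℚ (choose (suc (suc N)) (suc m))
  regroup : ∀ P b c HN Hr iN im → P * (HN - Hr) - im * b + c * (HN + iN - Hr) ≡ (c + P) * (HN + iN - Hr) - P * iN - im * b
  regroup = solve-∀ ℚ-ring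
  collect : ∀ Q G a b im → Q * G - a * im - im * b ≡ Q * G - im * (a + b)
  collect = solve-∀ ℚ-ring

choose-Htail-suc : ∀ s n →
  toℚ (choose (suc (s ℕ.+ n)) (suc s)) * Htail s n - inv (suc s) * toℚ (choose (s ℕ.+ n) (suc s))
    ≡ toℚ (choose (suc s ℕ.+ n) (suc s)) * Htail (suc s) n
choose-Htail-suc s n = begin
  P * (HN - Hs) - is * b                    ≡⟨ split-b P HN Hs is a b ⟩
  P * (HN - Hs) + a * is - (a + b) * is     ≡⟨ cong₂ (λ u v → P * (HN - Hs) + u - v * is) (sym (choose-absorbℚ N s)) (sym (toℚ-+ (choose N s) _)) ⟩
  P * (HN - Hs) + P * iN - P * is           ≡⟨ collect P HN Hs iN is ⟩
  P * (HN + iN - (Hs + is))                 ∎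
  where
  N = s ℕ.+ n
  HN = H N
  Hs = H s
  iN = inv (suc N)
  is = inv (suc s)
  a = toℚ (choose N s)
  b = toℚ (choose N (suc s))
  P = toℚ (choose (suc N) (suc s))
  split-b : ∀ P HN Hs is a b → P * (HN - Hs) - is * b ≡ P * (HN - Hs) + a * is - (a + b) * is
  split-b = solve-∀ ℚ-ring
  collect : ∀ P HN Hs iN is → P * (HN - Hs) + P * iN - P * is ≡ P * (HN + iN - (Hs + is))
  collect = solve-∀ ℚ-ring

HH-closed : ∀ r n → HH (suc r) n ≡ toℚ (choose (r ℕ.+ n) r) * Htail r n
HH-closed zero    n = unit (H n)
  where
  unit : ∀ h → h ≡ 1ℚ * (h - 0ℚ)
  unit = solve-∀ ℚ-ring
HH-closed (suc s) n = begin
  sum1 n (HH (suc s))                                               ≡⟨ sum1-cong n (HH-closed s) ⟩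
  sum1 n (λ l → toℚ (choose (s ℕ.+ l) s) * Htail s l)                ≡⟨ sum1≡sumTo n (λ l → toℚ (choose (s ℕ.+ l) s) * Htail s l) first-vanishes ⟩
  sumTo n (λ l → toℚ (choose (s ℕ.+ l) s) * Htail s l)               ≡⟨ sumTo-choose-Htail {s} {s} n ℕ.≤-refl ⟩
  toℚ (choose (suc (s ℕ.+ n)) (suc s)) * Htail s n - inv (suc s) * toℚ (choose (s ℕ.+ n) (suc s))
                                                                    ≡⟨ choose-Htail-suc s n ⟩
  toℚ (choose (suc s ℕ.+ n) (suc s)) * Htail (suc s) n              ∎
  where
  first-vanishes : toℚ (choose (s ℕ.+ 0) s) * Htail s 0 ≡ 0ℚ
  first-vanishes = trans (cong (toℚ (choose (s ℕ.+ 0) s) *_) (Htail-zero s)) (*-zeroʳ (toℚ (choose (s ℕ.+ 0) s)))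

Htail≡inv-choose*HH : ∀ r n → Htail r n ≡ inv (choose (r ℕ.+ n) r) * HH (suc r) n
Htail≡inv-choose*HH r n = sym (begin
  inv c * HH (suc r) n               ≡⟨ cong (inv c *_) (HH-closed r n) ⟩
  inv c * (toℚ c * Htail r n)         ≡⟨ *-assoc (inv c) (toℚ c) (Htail r n) ⟨
  inv c * toℚ c * Htail r n           ≡⟨ cong (_* Htail r n) (inv-*-toℚ c (choose-pos r n)) ⟩
  1ℚ * Htail r n                     ≡⟨ *-identityˡ (Htail r n) ⟩
  Htail r n                          ∎)
  where
  c = choose (r ℕ.+ n) r

A-factor B-factor : ℕ → ℕ → ℕ → ℚ
A-factor r n k = inv (choose (r ℕ.+ n) r) * toℚ (choose (r ℕ.+ k) k) * toℚ (choose (suc (r ℕ.+ n)) (suc (r ℕ.+ k)))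
B-factor r n k = inv (suc (r ℕ.+ k)) * toℚ (choose (r ℕ.+ k) k) * toℚ (choose (r ℕ.+ n) (suc (r ℕ.+ k)))

sumTo-choose-HH : ∀ r k n →
  sumTo n (λ l → toℚ (choose l k) * HH (suc r) l) ≡ A-factor r n k * HH (suc r) n - B-factor r n k
sumTo-choose-HH r k n = begin
  sumTo n (λ l → toℚ (choose l k) * HH (suc r) l)
    ≡⟨ sumTo-cong n revise ⟩
  sumTo n (λ l → D * (toℚ (choose (r ℕ.+ l) (r ℕ.+ k)) * Htail r l))
    ≡⟨ sumTo-*ˡ n D (λ l → toℚ (choose (r ℕ.+ l) (r ℕ.+ k)) * Htail r l) ⟩
  D * sumTo n (λ l → toℚ (choose (r ℕ.+ l) (r ℕ.+ k)) * Htail r l)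
    ≡⟨ cong (D *_) (sumTo-choose-Htail {r} {r ℕ.+ k} n (ℕ.m≤m+n r k)) ⟩
  D * (C₁ * Htail r n - im * C₂)
    ≡⟨ cong (λ z → D * (C₁ * z - im * C₂)) (Htail≡inv-choose*HH r n) ⟩
  D * (C₁ * (inv c * HH (suc r) n) - im * C₂)
    ≡⟨ rearrange D C₁ (inv c) (HH (suc r) n) im C₂ ⟩
  A-factor r n k * HH (suc r) n - B-factor r n k ∎
  where
  c = choose (r ℕ.+ n) r
  D = toℚ (choose (r ℕ.+ k) k)
  C₁ = toℚ (choose (suc (r ℕ.+ n)) (suc (r ℕ.+ k)))
  C₂ = toℚ (choose (r ℕ.+ n) (suc (r ℕ.+ k)))
  im = inv (suc (r ℕ.+ k))
  revise : ∀ l → toℚ (choose l k) * HH (suc r) l ≡ D * (toℚ (choose (r ℕ.+ l) (r ℕ.+ k)) * Htail r l)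
  revise l = begin
    toℚ (choose l k) * HH (suc r) l
      ≡⟨ cong (toℚ (choose l k) *_) (HH-closed r l) ⟩
    toℚ (choose l k) * (toℚ (choose (r ℕ.+ l) r) * Htail r l)
      ≡⟨ *-assoc (toℚ (choose l k)) _ (Htail r l) ⟨
    toℚ (choose l k) * toℚ (choose (r ℕ.+ l) r) * Htail r l
      ≡⟨ cong (_* Htail r l) (trans (sym (toℚ-* (choose l k) _)) (trans (cong toℚ (choose-revision r k l)) (toℚ-* (choose (r ℕ.+ k) k) _))) ⟩
    D * toℚ (choose (r ℕ.+ l) (r ℕ.+ k)) * Htail r l
      ≡⟨ *-assoc D _ (Htail r l) ⟩
    D * (toℚ (choose (r ℕ.+ l) (r ℕ.+ k)) * Htail r l) ∎
  rearrange : ∀ D C₁ ic h im C₂ → D * (C₁ * (ic * h) - im * C₂) ≡ ic * D * C₁ * h - im * D * C₂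
  rearrange = solve-∀ ℚ-ring

A-suc : ∀ p r n → A p (suc r) n ≡ sumTo p (λ k → toℚ (S p k ℕ.* k !) * A-factor r n k)
A-suc p r n = sumTo-cong p summand
  where
  normalise-index : (n ℕ.+ suc r ∸ 1) C r ≡ choose (r ℕ.+ n) r
  normalise-index = trans (cong (λ m → (m ∸ 1) C r) (trans (ℕ.+-suc n r) (cong suc (ℕ.+-comm n r))))
                          (sym (choose≡C (r ℕ.+ n) r))
  summand : ∀ k →
    toℚ (S p k ℕ.* k !) * inv ((n ℕ.+ suc r ∸ 1) C r) * toℚ ((r ℕ.+ k) C k) * toℚ (suc (r ℕ.+ n) C suc (r ℕ.+ k))
      ≡ toℚ (S p k ℕ.* k !) * A-factor r n k
  summand k = trans
    (cong₂ _*_ (cong₂ (λ x y → a * inv x * toℚ y) normalise-index (sym (choose≡C (r ℕ.+ k) k)))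
               (cong toℚ (sym (choose≡C (suc (r ℕ.+ n)) (suc (r ℕ.+ k))))))
    (reassoc a (inv (choose (r ℕ.+ n) r)) (toℚ (choose (r ℕ.+ k) k)) (toℚ (choose (suc (r ℕ.+ n)) (suc (r ℕ.+ k)))))
    where
    a = toℚ (S p k ℕ.* k !)
    reassoc : ∀ a i d c → a * i * d * c ≡ a * (i * d * c)
    reassoc = solve-∀ ℚ-ring

B-suc : ∀ p r n → B p (suc r) n ≡ sumTo p (λ k → toℚ (S p k ℕ.* k !) * B-factor r n k)
B-suc p r n = sumTo-cong p summand
  where
  summand : ∀ k →
    inv (suc (r ℕ.+ k)) * toℚ (S p k ℕ.* k !) * toℚ ((r ℕ.+ k) C k) * toℚ ((r ℕ.+ n) C suc (r ℕ.+ k))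
      ≡ toℚ (S p k ℕ.* k !) * B-factor r n k
  summand k = trans
    (cong₂ (λ y z → im * a * toℚ y * toℚ z) (sym (choose≡C (r ℕ.+ k) k)) (sym (choose≡C (r ℕ.+ n) (suc (r ℕ.+ k)))))
    (reorder im a (toℚ (choose (r ℕ.+ k) k)) (toℚ (choose (r ℕ.+ n) (suc (r ℕ.+ k)))))
    where
    a = toℚ (S p k ℕ.* k !)
    im = inv (suc (r ℕ.+ k))
    reorder : ∀ i a d c → i * a * d * c ≡ a * (i * d * c)
    reorder = solve-∀ ℚ-ring

corollary2 : ∀ (n r p : ℕ) → 1 ≤ n → 1 ≤ r → 1 ≤ p →
    sumTo n (λ ℓ → toℚ (ℓ ^ p) * HH r ℓ) ≡ A p r n * HH r n - B p r n
corollary2 n zero    p _ () _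
corollary2 n (suc r) p _ _ _ = begin
  sumTo n (λ l → toℚ (l ^ p) * HH (suc r) l)
    ≡⟨ sumTo-power-weighted p n (HH (suc r)) ⟩
  sumTo p (λ k → a k * sumTo n (λ l → toℚ (choose l k) * HH (suc r) l))
    ≡⟨ sumTo-cong p (λ k → cong (a k *_) (sumTo-choose-HH r k n)) ⟩
  sumTo p (λ k → a k * (A-factor r n k * HH (suc r) n - B-factor r n k))
    ≡⟨ sumTo-*-affine p (HH (suc r) n) a (A-factor r n) (B-factor r n) ⟩
  sumTo p (λ k → a k * A-factor r n k) * HH (suc r) n - sumTo p (λ k → a k * B-factor r n k)
    ≡⟨ cong₂ (λ α β → α * HH (suc r) n - β) (A-suc p r n) (B-suc p r n) ⟨
  A p (suc r) n * HH (suc r) n - B p (suc r) n ∎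
  where
  a : ℕ → ℚ
  a k = toℚ (S p k ℕ.* k !)
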